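{- Let $(N_1,m_1)\vartriangleright_E(N_2,m_2)$ and let $G$ be a well-formed TFG for this equivalence. For every marking $m_1'$ of $N_1$ there exists at most one total, well-defined configuration $c$ of $G$ with $c\equiv m_1'$.
   Context: A Petri net $N=(P,T,\mathrm{Pre},\mathrm{Post})$ has a finite set of places $P$, a finite set of transitions $T$, and flow functions $\mathrm{Pre},\mathrm{Post}:T\to(P\to\mathbb{N})$. A marking is $m:P\to\mathbb{N}$; $t$ is enabled at $m$ if $m\ge\mathrm{Pre}(t)$, and firing gives $m-\mathrm{Pre}(t)+\mathrm{Post}(t)$. $R(N,m_0)$ is the set of markings reachable from $m_0$ by finite (possibly empty) firing sequences. Linear systems: $E$ is a finite collection of equations $x=y_1+\dots+y_l$, with variable set $\mathrm{fv}(E)$; solutions are non-negative integer; consistent means having a solution. For a partial map $c$ defined exactly on $v_1,\dots,v_k$, $[c]$ is the system $v_1=c(v_1),\dots,v_k=c(v_k)$; commas denote union. $E$-equivalence: $(N_1,m_1)\vartriangleright_E(N_2,m_2)$ (place sets $P_1,P_2$) iff (A1) $E,[m]$ consistent for every $m\in R(N_1,m_1)\cup R(N_2,m_2)$; (A2) $E,[m_1],[m_2]$ consistent; (A3) for all markings $m_1'$ of $N_1$, $m_2'$ of $N_2$ with $E,[m_1'],[m_2']$ consistent, $m_1'\in R(N_1,m_1)\iff m_2'\in R(N_2,m_2)$. TFGs: fix pairwise disjoint sets $K(n)$, $n\in\mathbb{N}$, of constant nodes of value $n$, disjoint from place/variable names; $K=\bigcup_nK(n)$. A TFG with places $P$ is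 $(V,R,A)$, $V=P\cup S$ with $S\subset K$ finite, $R,A\subseteq V\times V$ disjoint; $v\mathbin{\to\!\bullet} w$ iff $(v,w)\in R$, $v\mathbin{\circ\!\to} w$ iff $(v,w)\in A$, $v\to w$ for either. Roots have no incoming arc; $\circ$-leaves have no outgoing $A$-arc. $v\mathbin{\circ\!\to} X$: $X$ is the nonempty set of all $A$-successors of $v$; $X\mathbin{\to\!\bullet} v$: $X$ is the nonempty set of all $R$-predecessors of $v$. Well-formed TFG for $(N_1,m_1)\vartriangleright_E(N_2,m_2)$: (T1) $V\setminus K=P_1\cup P_2\cup\mathrm{fv}(E)$; (T2) nodes in $V\cap K$ are roots; (T3) not both $p\mathbin{\circ\!\to} q$ and $p'\to q$ with $p\ne p'$, and not both $p\mathbin{\to\!\bullet} q$ and $p\mathbin{\circ\!\to} q$; (T4) $v\mathbin{\circ\!\to} X$ or $X\mathbin{\to\!\bullet} v$ iff the equation $v=\sum_{x\in X}x$ is in $E$; (T5) acyclic; (T6) roots not in $K$ are exactly $P_2$, $\circ$-leaves not in $K$ exactly $P_1$. A configuration is a partial $c:V\to\mathbb{N}$ ($\bot$ where undefined) with $c(v)=n$ for $v\in V\cap K(n)$; total if defined everywhere. For a marking $m$, $c\equiv m$ means $c(p)=m(p)$ for all places $p$ where both are defined. $c$ is well-defined if (CBot) whenever $v\to w$, $c(v)=\bot\iff c(w)=\bot$; (CEq) whenever $c(v)\ne\bot$ and ($v\mathbin{\circ\!\to} X$ or $X\mathbin{\to\!\bullet} v$), $c(v)=\sum_{x\in X}c(x)$.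 -}

module Defs where

open import Data.Nat using (ℕ; _≤_; _+_)
open import Data.Empty using (⊥)
open import Data.List using (List; []; _∷_; map)
open import Data.Nat.ListAction using (sum)
open import Data.List.Membership.Propositional using (_∈_)
open import Data.List.Relation.Unary.Unique.Propositional using (Unique)
open import Data.List.Relation.Binary.Permutation.Propositional using (_↭_)
open import Data.Product using (Σ; ∃; _×_; _,_)
open import Data.Sum using (_⊎_)
open import Data.Maybe using (Maybe; just; nothing)
open import Relation.Binary.PropositionalEquality using (_≡_; _≢_)
open import Relation.Binary.Construct.Closure.Transitive using (TransClosure)
open import Relation.Nullary using (¬_)
open import Function.Bundles using (_⇔_)

-- Places and variables are drawn from an arbitrary type A of
-- names.  A marking of a net with place list P is represented by a
-- function A → ℕ of which only the values on P matter (all notions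
-- below only inspect markings on the places of the net).

Marking : Set → Set
Marking A = A → ℕ

record Transition (A : Set) : Set where
  field
    pre  : A → ℕ
    post : A → ℕ

record PetriNet (A : Set) : Set where
  field
    places      : List A
    transitions : List (Transition A)

module _ {A : Set} (N : PetriNet A) where
  open PetriNet N

  Enabled : Transition A → Marking A → Set
  Enabled t m = ∀ p → p ∈ places → Transition.pre t p ≤ m p

  Fires : Marking A → Transition A → Marking A → Set
  Fires m t m' = Enabled t m ×
    (∀ p → p ∈ places → m' p + Transition.pre t p ≡ m p + Transition.post t p)

  data Reach (m0 : Marking A) : Marking A → Set where
    base : ∀ {m} → (∀ p → p ∈ places → m p ≡ m0 p) → Reach m0 m
    step : ∀ {m t m'} → Reach m0 m → t ∈ transitions → Fires m t m' → Reach m0 m'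

-- Nodes: variables/places (var a) and constant nodes.
-- cst n i is the i-th constant node of value n, so K(n) = { cst n i | i }.

data Node (A : Set) : Set where
  var : A → Node A
  cst : ℕ → ℕ → Node A

record Equation (A : Set) : Set where
  field
    lhs : Node A
    rhs : List (Node A)

open Equation public

module _ {A : Set} where

  eval : (A → ℕ) → Node A → ℕ
  eval σ (var a)   = σ a
  eval σ (cst n i) = n

  Solution : List (Equation A) → (A → ℕ) → Set
  Solution E σ = ∀ e → e ∈ E → eval σ (lhs e) ≡ sum (map (eval σ) (rhs e))

  AgreesOn : List A → Marking A → (A → ℕ) → Set
  AgreesOn P m σ = ∀ p → p ∈ P → σ p ≡ m p

  Consistent₁ : List (Equation A) → List A → Marking A → Set
  Consistent₁ E P m = ∃ λ σ → Solution E σ × AgreesOn P m σ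

  Consistent₂ : List (Equation A) → List A → Marking A → List A → Marking A → Set
  Consistent₂ E P₁ m₁ P₂ m₂ =
    ∃ λ σ → Solution E σ × AgreesOn P₁ m₁ σ × AgreesOn P₂ m₂ σ

  _∈fv_ : A → List (Equation A) → Set
  a ∈fv E = ∃ λ e → e ∈ E × (lhs e ≡ var a ⊎ var a ∈ rhs e)

record EEquiv {A : Set} (N₁ : PetriNet A) (m₁ : Marking A)
              (N₂ : PetriNet A) (m₂ : Marking A) (E : List (Equation A)) : Set where
  open PetriNet N₁ renaming (places to P₁)
  open PetriNet N₂ renaming (places to P₂)
  field
    A1₁ : ∀ m → Reach N₁ m₁ m → Consistent₁ E P₁ m
    A1₂ : ∀ m → Reach N₂ m₂ m → Consistent₁ E P₂ m
    A2  : Consistent₂ E P₁ m₁ P₂ m₂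
    A3  : ∀ m₁' m₂' → Consistent₂ E P₁ m₁' P₂ m₂' →
          (Reach N₁ m₁ m₁' ⇔ Reach N₂ m₂ m₂')

record TFG (A : Set) : Set where
  field
    nodes : List (Node A)
    R     : List (Node A × Node A)
    Aa    : List (Node A × Node A)

module _ {A : Set} (G : TFG A) where
  open TFG G

  Arc : Node A → Node A → Set
  Arc v w = (v , w) ∈ R ⊎ (v , w) ∈ Aa

  Root : Node A → Set
  Root v = ∀ u → ¬ Arc u v

  OLeaf : Node A → Set
  OLeaf v = ∀ w → ¬ ((v , w) ∈ Aa)

  SuccA : Node A → List (Node A) → Set
  SuccA v X = Unique X × X ≢ [] × (∀ w → w ∈ X ⇔ (v , w) ∈ Aa)

  PredR : Node A → List (Node A) → Set
  PredR v X = Unique X × X ≢ [] × (∀ w → w ∈ X ⇔ (w , v) ∈ R)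

EqIn : {A : Set} → List (Equation A) → Node A → List (Node A) → Set
EqIn E v X = ∃ λ e → e ∈ E × lhs e ≡ v × rhs e ↭ X

record WellFormed {A : Set} (N₁ N₂ : PetriNet A) (E : List (Equation A))
                  (G : TFG A) : Set where
  open TFG G
  open PetriNet N₁ renaming (places to P₁)
  open PetriNet N₂ renaming (places to P₂)
  field
    R⊆V  : ∀ v w → (v , w) ∈ R → v ∈ nodes × w ∈ nodes
    A⊆V  : ∀ v w → (v , w) ∈ Aa → v ∈ nodes × w ∈ nodes
    R∩A  : ∀ v w → (v , w) ∈ R → (v , w) ∈ Aa → ⊥
    T1   : ∀ a → var a ∈ nodes ⇔ (a ∈ P₁ ⊎ a ∈ P₂ ⊎ a ∈fv E)
    T2   : ∀ n i → cst n i ∈ nodes → Root G (cst n i)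
    T3a  : ∀ p p' q → ¬ ((p , q) ∈ Aa × Arc G p' q × p ≢ p')
    T3b  : ∀ p q → ¬ ((p , q) ∈ R × (p , q) ∈ Aa)
    T4   : ∀ v X → Unique X → (SuccA G v X ⊎ PredR G v X) ⇔ EqIn E v X
    T5   : ∀ v → ¬ TransClosure (Arc G) v v
    T6r  : ∀ a → (var a ∈ nodes × Root G (var a)) ⇔ a ∈ P₂
    T6l  : ∀ a → (var a ∈ nodes × OLeaf G (var a)) ⇔ a ∈ P₁

-- Configurations: partial maps V → ℕ, represented as Node A → Maybe ℕ
-- (nothing = ⊥); only values on V matter.

Config : Set → Set
Config A = Node A → Maybe ℕ

msum : List (Maybe ℕ) → Maybe ℕ
msum []              = just 0
msum (nothing ∷ xs)  = nothing
msum (just n  ∷ xs)  with msum xs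
... | just s  = just (n + s)
... | nothing = nothing

module _ {A : Set} (G : TFG A) (c : Config A) where
  open TFG G

  IsConfiguration : Set
  IsConfiguration = ∀ n i → cst n i ∈ nodes → c (cst n i) ≡ just n

  Total : Set
  Total = ∀ v → v ∈ nodes → ∃ λ n → c v ≡ just n

  WellDefined : Set
  WellDefined =
    (∀ v w → Arc G v w → (c v ≡ nothing ⇔ c w ≡ nothing)) ×
    (∀ v k → c v ≡ just k → ∀ X → SuccA G v X ⊎ PredR G v X →
       msum (map c X) ≡ just k)

Matches : {A : Set} → List A → Config A → Marking A → Set
Matches P c m = ∀ p → p ∈ P → ∀ k → c (var p) ≡ just k → k ≡ m p

{-# OPTIONS --safe #-}
-- If two such configurations c and c' differed at a node, they would differ at
-- one of its ∘-successors: constants have fixed values, ∘-leaves are places of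
-- N₁ where both equal m₁', and every other node carries the sum of its
-- ∘-successors (CEq).  Chasing disagreements thus yields ever longer arc paths
-- in the finite graph, contradicting acyclicity (T5).  Node equality is undecidable, so the
-- set of ∘-successors of a node is only available under double negation, which
-- suffices because equality of configuration values is decidable.
module Submission where

open import Defs
open import Data.List using (List; []; _∷_; length; map)
open import Data.List.Properties using (length-removeAt′; map-cong-local)
open import Data.List.Membership.Propositional using (_∈_)
open import Data.List.Relation.Unary.Any using (here; there; index; _─_)
open import Data.List.Relation.Unary.Any.Properties using (¬Any[])
open import Data.List.Relation.Unary.All using (tabulate)
open import Data.List.Relation.Unary.All.Properties using (¬Any⇒All¬)
open import Data.List.Relation.Unary.AllPairs using ([]; _∷_)
open import Data.List.Relation.Unary.Unique.Propositional using (Unique)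
open import Data.Nat using (suc; zero; _≟_)
open import Data.Nat.Properties using (suc-injective)
open import Data.Maybe using (just)
open import Data.Maybe.Properties using (≡-dec)
open import Data.Empty using (⊥; ⊥-elim)
open import Data.Product using (∃; _×_; _,_; proj₁; proj₂)
open import Data.Sum using (inj₁; inj₂)
open import Effect.Monad using (RawMonad)
open import Function.Base using (_∘′_)
open import Function.Bundles using (_⇔_; mk⇔; Equivalence)
open import Relation.Binary.Construct.Closure.Transitive using (TransClosure; [_]; _∷_)
open import Relation.Binary.PropositionalEquality using (_≡_; _≢_; refl; sym; trans; cong; module ≡-Reasoning)
open import Relation.Nullary using (¬_; Dec; yes; no)
open import Relation.Nullary.Decidable using (decidable-stable; ¬¬-excluded-middle)
open import Relation.Nullary.Negation using (¬¬-Monad; contradiction)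

open Equivalence

module _ {B : Set} where

  ∈-─ : ∀ {x y} {xs : List B} (x∈xs : x ∈ xs) → y ∈ xs → y ≢ x → y ∈ (xs ─ x∈xs)
  ∈-─ (here x≡z) (here y≡z) y≢x = ⊥-elim (y≢x (trans y≡z (sym x≡z)))
  ∈-─ (here _)   (there y∈) _   = y∈
  ∈-─ (there _)  (here y≡z) _   = here y≡z
  ∈-─ (there x∈) (there y∈) y≢x = there (∈-─ x∈ y∈ y≢x)

  SuccessorSet : B → List (B × B) → List B → Set
  SuccessorSet v L X = Unique X × (∀ w → w ∈ X ⇔ (v , w) ∈ L)

  successorSet-∷ : ∀ {v a b L X} → Dec (a ≡ v) → Dec (b ∈ X) →
                   SuccessorSet v L X → ∃ (SuccessorSet v ((a , b) ∷ L))
  successorSet-∷ {X = X} (no a≢v) _ (uX , X⇔) = X , uX , λ w → mk⇔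
    (there ∘′ to (X⇔ w))
    λ { (here refl) → contradiction refl a≢v ; (there h) → from (X⇔ w) h }
  successorSet-∷ {X = X} (yes refl) (yes b∈X) (uX , X⇔) = X , uX , λ w → mk⇔
    (λ w∈X → there (to (X⇔ w) w∈X))
    λ { (here refl) → b∈X ; (there h) → from (X⇔ w) h }
  successorSet-∷ {b = b} {X = X} (yes refl) (no b∉X) (uX , X⇔) =
    b ∷ X , ¬Any⇒All¬ X b∉X ∷ uX , λ w → mk⇔
    (λ { (here refl) → here refl ; (there w∈X) → there (to (X⇔ w) w∈X) })
    λ { (here refl) → here refl ; (there h) → there (from (X⇔ w) h) }

  ¬¬-successorSet : (v : B) (L : List (B × B)) → ¬ ¬ ∃ (SuccessorSet v L)
  ¬¬-successorSet v [] = contradiction ([] , [] , λ w → mk⇔ (λ ()) (λ ()))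
  ¬¬-successorSet v ((a , b) ∷ L) = do
    (X , succX) ← ¬¬-successorSet v L
    a≟v ← ¬¬-excluded-middle
    b∈?X ← ¬¬-excluded-middle
    pure (successorSet-∷ a≟v b∈?X succX)
    where open RawMonad ¬¬-Monad

module _ {B : Set} (_⟶_ : B → B → Set) where

  Acyclic : Set
  Acyclic = ∀ v → ¬ TransClosure _⟶_ v v

  Progressive : (B → Set) → Set
  Progressive P = ∀ u → P u → ¬ ¬ ∃ λ w → u ⟶ w × P w

  module _ {P : B → Set} (acyclic : Acyclic) (progressive : Progressive P) where

    private
      -- Along a descent the bound shrinks by one node per step, since by acyclicity
      -- a node is not in its own strict reach.
      BoundedBy : List B → B → Set
      BoundedBy ns u = ∀ {z} → TransClosure _⟶_ u z → P z → z ∈ ns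

      bounded-─ : ∀ {ns u w} → BoundedBy ns u → u ⟶ w → (w∈ns : w ∈ ns) →
                  BoundedBy (ns ─ w∈ns) w
      bounded-─ bounded u⟶w w∈ns {z} w⟶⁺z Pz =
        ∈-─ w∈ns (bounded (u⟶w ∷ w⟶⁺z) Pz) λ { refl → acyclic z w⟶⁺z }

      descent : ∀ n ns → length ns ≡ n → ∀ u → P u → BoundedBy ns u → ⊥
      descent zero [] _ u Pu bounded =
        progressive u Pu λ (_ , u⟶w , Pw) → ¬Any[] (bounded [ u⟶w ] Pw)
      descent (suc n) ns len u Pu bounded = progressive u Pu λ (w , u⟶w , Pw) →
        let w∈ns = bounded [ u⟶w ] Pw in
        descent n (ns ─ w∈ns) (suc-injective (trans (sym (length-removeAt′ ns (index w∈ns))) len))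
          w Pw (bounded-─ bounded u⟶w w∈ns)

    progressive-finite⇒empty : (ns : List B) → (∀ {u} → P u → u ∈ ns) → ∀ u → ¬ P u
    progressive-finite⇒empty ns P⊆ns u Pu = descent (length ns) ns refl u Pu (λ _ → P⊆ns)

record TotalConfigMatching {A : Set} (G : TFG A) (P : List A) (m : Marking A)
                           (c : Config A) : Set where
  field
    isConfiguration : IsConfiguration G c
    total           : Total G c
    wellDefined     : WellDefined G c
    matches         : Matches P c m

module _ {A : Set} {N₁ N₂ : PetriNet A} {E : List (Equation A)} {G : TFG A}
         (wf : WellFormed N₁ N₂ E G) {m : Marking A} where

  open TFG G
  open WellFormed wf
  open PetriNet N₁ renaming (places to P₁)

  module _ {c : Config A} (cfg : TotalConfigMatching G P₁ m c) where
    open TotalConfigMatching cfg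

    value-of-P₁ : ∀ {a} → a ∈ P₁ → var a ∈ nodes → c (var a) ≡ just (m a)
    value-of-P₁ a∈P₁ a∈V with total _ a∈V
    ... | k , ca≡k = trans ca≡k (cong just (matches _ a∈P₁ k ca≡k))

    value-as-sum : ∀ {v X} → v ∈ nodes → SuccA G v X → c v ≡ msum (map c X)
    value-as-sum {v} {X} v∈V succ with total v v∈V
    ... | k , cv≡k = trans cv≡k (sym (proj₂ wellDefined v k cv≡k X (inj₁ succ)))

  module _ {c c' : Config A}
           (cfg : TotalConfigMatching G P₁ m c) (cfg' : TotalConfigMatching G P₁ m c') where
    open TotalConfigMatching
    open ≡-Reasoning

    Disagree : Node A → Set
    Disagree u = u ∈ nodes × c u ≢ c' u

    agree-on-successors : ∀ {v} X → v ∈ nodes → SuccessorSet v Aa X →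
                          (∀ {w} → w ∈ X → c w ≡ c' w) → c v ≡ c' v
    agree-on-successors {var a} [] v∈V (_ , X⇔) _ =
      trans (value-of-P₁ cfg a∈P₁ v∈V) (sym (value-of-P₁ cfg' a∈P₁ v∈V))
      where a∈P₁ = to (T6l a) (v∈V , λ w h → ¬Any[] (from (X⇔ w) h))
    agree-on-successors {cst n i} [] v∈V _ _ =
      trans (isConfiguration cfg n i v∈V) (sym (isConfiguration cfg' n i v∈V))
    agree-on-successors {v} X@(_ ∷ _) v∈V (uX , X⇔) agree = begin
      c v             ≡⟨ value-as-sum cfg v∈V succ ⟩
      msum (map c X)  ≡⟨ cong msum (map-cong-local (tabulate agree)) ⟩
      msum (map c' X) ≡⟨ value-as-sum cfg' v∈V succ ⟨
      c' v            ∎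
      where
      succ : SuccA G v X
      succ = uX , (λ ()) , X⇔

    disagreement-propagates : Progressive (Arc G) Disagree
    disagreement-propagates v (v∈V , c≢c') no-successor =
      ¬¬-successorSet v Aa λ (X , succX@(_ , X⇔)) →
        c≢c' (agree-on-successors X v∈V succX λ {w} w∈X →
          decidable-stable (≡-dec _≟_ (c w) (c' w)) λ c≢c'ʷ →
            let v⟶w = to (X⇔ w) w∈X in
            no-successor (w , inj₂ v⟶w , (proj₂ (A⊆V _ _ v⟶w) , c≢c'ʷ)))

    agree-everywhere : ∀ v → v ∈ nodes → c v ≡ c' v
    agree-everywhere v v∈V = decidable-stable (≡-dec _≟_ (c v) (c' v)) λ c≢c' →
      progressive-finite⇒empty (Arc G) T5 disagreement-propagates nodes proj₁ v (v∈V , c≢c')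

lemma3 : {A : Set} (N₁ N₂ : PetriNet A) (m₁ m₂ : Marking A) (E : List (Equation A)) →
         EEquiv N₁ m₁ N₂ m₂ E →
         (G : TFG A) → WellFormed N₁ N₂ E G →
         (m₁' : Marking A) (c c' : Config A) →
         IsConfiguration G c → Total G c → WellDefined G c →
         Matches (PetriNet.places N₁) c m₁' →
         IsConfiguration G c' → Total G c' → WellDefined G c' →
         Matches (PetriNet.places N₁) c' m₁' →
         ∀ v → v ∈ TFG.nodes G → c v ≡ c' v
lemma3 N₁ N₂ m₁ m₂ E _ G wf m₁' c c' ic tc wd mt ic' tc' wd' mt' =
  agree-everywhere wf (record { isConfiguration = ic ; total = tc ; wellDefined = wd ; matches = mt })
                      (record { isConfiguration = ic' ; total = tc' ; wellDefined = wd' ; matches = mt' })
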